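{- If $G$ is a digraph with $\delta^0(G)\ge |V(G)|/2$, then $G$ has a CISA of size $2$.
   Context: $\delta^-(G)$ and $\delta^+(G)$ are the minimum in-degree and out-degree of $G$, and $\delta^0(G)=\min\{\delta^-(G),\delta^+(G)\}$. For a directed tree $T$, $\mathrm{int}(T)$ is the set of vertices of degree at least 2 in the underlying undirected tree. An arborescence is a tree in which every vertex except one (the root, of in-degree 0) has in-degree exactly 1 in the tree. A CISA of size $k$ in a digraph $G$ is a set $\{T_1,\dots,T_k\}$ of spanning arborescences of $G$ with $\mathrm{int}(T_i)\cap\mathrm{int}(T_j)=\emptyset$ and $A(T_i)\cap A(T_j)=\emptyset$ for all distinct $i,j$. -}

module Defs where

open import Data.Nat using (ℕ; zero; suc; _+_; _*_; _≤_; _≥_)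
open import Data.Fin using (Fin)
open import Data.Bool using (Bool; true; false; if_then_else_)
open import Data.List using (List; map; allFin)
open import Data.Nat.ListAction using (sum)
open import Data.Product using (_×_; ∃-syntax)
open import Relation.Binary.PropositionalEquality using (_≡_; _≢_)
open import Relation.Nullary using (¬_)

-- A digraph on the vertex set Fin n (finite, loopless, no parallel arcs;
-- digons u→v, v→u are allowed).  adj u v ≡ true  means  (u,v) is an arc.
record Digraph : Set where
  field
    n        : ℕ
    adj      : Fin n → Fin n → Bool
    loopless : ∀ v → adj v v ≡ false
open Digraph public

ArcSet : ℕ → Set
ArcSet n = Fin n → Fin n → Bool

count : ∀ {n} → (Fin n → Bool) → ℕ
count {n} p = sum (map (λ i → if p i then 1 else 0) (allFin n))

outdeg indeg : ∀ {n} → ArcSet n → Fin n → ℕ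
outdeg A v = count (λ w → A v w)
indeg  A v = count (λ u → A u v)

deg : ∀ {n} → ArcSet n → Fin n → ℕ
deg A v = indeg A v + outdeg A v

arcCount : ∀ {n} → ArcSet n → ℕ
arcCount A = sum (map (λ u → outdeg A u) (allFin _))

MinSemidegreeAtLeastHalf : Digraph → Set
MinSemidegreeAtLeastHalf G =
  ∀ v → (2 * outdeg (adj G) v ≥ n G) × (2 * indeg (adj G) v ≥ n G)

_⊆ᴬ_ : ∀ {n} → ArcSet n → ArcSet n → Set
T ⊆ᴬ A = ∀ u v → T u v ≡ true → A u v ≡ true

data UWalk {n} (T : ArcSet n) : Fin n → Fin n → Set where
  here  : ∀ {u} → UWalk T u u
  fwd   : ∀ {u w v} → T u w ≡ true → UWalk T w v → UWalk T u v
  bwd   : ∀ {u w v} → T w u ≡ true → UWalk T w v → UWalk T u v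

IsSpanningTree : ∀ {n} → ArcSet n → Set
IsSpanningTree {n} T = (∀ u v → UWalk T u v) × (arcCount T + 1 ≡ n)

IsSpanningArborescence : (G : Digraph) → ArcSet (n G) → Set
IsSpanningArborescence G T =
  (T ⊆ᴬ adj G) × IsSpanningTree T ×
  (∃[ r ] (indeg T r ≡ 0 × (∀ v → v ≢ r → indeg T v ≡ 1)))

Interior : ∀ {n} → ArcSet n → Fin n → Set
Interior T v = 2 ≤ deg T v

HasCISA2 : Digraph → Set
HasCISA2 G = ∃[ T₁ ] ∃[ T₂ ]
  ( IsSpanningArborescence G T₁ × IsSpanningArborescence G T₂
  × (∀ v → ¬ (Interior T₁ v × Interior T₂ v))
  × (∀ u v → ¬ (T₁ u v ≡ true × T₂ u v ≡ true)) )

-- Let k = ⌈n/2⌉, so every vertex has at least k in- and k out-neighbours.  Fix a vertex a,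
-- a set K of k out-neighbours of a, and let M be the remaining n - 1 - k < k vertices.  A
-- counting argument yields a centre c ∈ K from which every vertex of M is reachable by a walk
-- inside M.  Split the vertices into I₁ = ({a} ∪ K) ∖ {c} and its complement {c} ∪ M; both
-- sides have at most k elements, so every vertex has an in-neighbour outside its own side.
-- T₁ is rooted at a: it joins a to K and hangs every other vertex from an in-neighbour in I₁.
-- T₂ is rooted at c: it is a breadth-first tree of {c} ∪ M inside M, and hangs every vertex of
-- I₁ from an in-neighbour in {c} ∪ M.  The tail of every arc and every interior vertex of Tᵢ
-- lie on side i, so the two arborescences are arc-disjoint with disjoint interiors.

module Submission where

open import Defs
open import Data.Nat
  using (ℕ; zero; suc; _+_; _*_; _≤_; _<_; _≥_; z≤n; s≤s; ⌈_/2⌉; _≤′_; ≤′-refl; ≤′-step)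
open import Data.Nat.Properties hiding (_≟_)
open import Data.Nat.ListAction using (sum)
open import Algebra.Properties.CommutativeMonoid.Sum +-0-commutativeMonoid
  using (sum-syntax; sum-cong-≗; ∑-distrib-+; ∑-comm)
open import Algebra.Properties.CommutativeSemigroup +-commutativeSemigroup using (interchange)
open import Data.Fin using (Fin; zero; suc; fromℕ<)
open import Data.Fin.Properties using (_≟_; any?; all?)
open import Data.Bool using (Bool; true; false; _∧_; _∨_; not; if_then_else_)
open import Data.Bool.Properties
  using (∧-conicalˡ; ∧-conicalʳ; ∧-zeroʳ; ∨-zeroʳ; ¬-not; not-injective) renaming (_≟_ to _≟ᴮ_)
open import Data.List using (map; allFin; tabulate)
open import Data.List.Properties using (map-tabulate)
open import Data.Product using (_×_; _,_; proj₁; proj₂; ∃)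
open import Data.Sum using (_⊎_; inj₁; inj₂)
open import Data.Empty using (⊥; ⊥-elim)
open import Function using (_∘_; id; case_of_)
open import Data.Vec.Functional using (_∷_)
open import Relation.Binary.PropositionalEquality
open import Relation.Nullary using (Dec; yes; no; does; contradiction)
open import Relation.Nullary.Decidable using (dec-true; dec-false; does-⇔; _→-dec_; _×-dec_)
open import Function.Bundles using (mk⇔)
open import Induction.WellFounded using (Acc; acc)
open import Data.Nat.Induction using (<-wellFounded)

VertexSet : ℕ → Set
VertexSet n = Fin n → Bool

𝟙 : Bool → ℕ
𝟙 b = if b then 1 else 0

does-true : ∀ {P : Set} (P? : Dec P) → does P? ≡ true → P
does-true (yes p) _ = p

module _ {n : ℕ} where

  infix 4 _∈_ _∉_ _⊆_
  infixr 7 _∩_ _∖_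
  infixr 6 _∪_

  _∈_ _∉_ : Fin n → VertexSet n → Set
  v ∈ p = p v ≡ true
  v ∉ p = p v ≡ false

  _⊆_ : VertexSet n → VertexSet n → Set
  p ⊆ q = ∀ v → v ∈ p → v ∈ q

  _∩_ _∪_ _∖_ : VertexSet n → VertexSet n → VertexSet n
  (p ∩ q) v = p v ∧ q v
  (p ∪ q) v = p v ∨ q v
  (p ∖ q) v = p v ∧ not (q v)

  ∁ : VertexSet n → VertexSet n
  ∁ p v = not (p v)

  ∅ : VertexSet n
  ∅ _ = false

  ⁅_⁆ : Fin n → VertexSet n
  ⁅ u ⁆ v = does (v ≟ u)

  ∣_∣ : VertexSet n → ℕ
  ∣ p ∣ = ∑[ v < n ] 𝟙 (p v)

  ∈⁅⁆⇒≡ : ∀ {u v} → v ∈ ⁅ u ⁆ → v ≡ u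
  ∈⁅⁆⇒≡ {u} {v} = does-true (v ≟ u)

  u∈⁅u⁆ : ∀ u → u ∈ ⁅ u ⁆
  u∈⁅u⁆ u = dec-true (u ≟ u) refl

  ≢⇒∉⁅⁆ : ∀ {u v} → v ≢ u → v ∉ ⁅ u ⁆
  ≢⇒∉⁅⁆ {u} {v} v≢u = dec-false (v ≟ u) v≢u

  _⊆?_ : (p q : VertexSet n) → Dec (p ⊆ q)
  p ⊆? q = all? (λ v → (p v ≟ᴮ true) →-dec (q v ≟ᴮ true))

module _ {n} {p q : VertexSet n} {v : Fin n} where

  x∈p∩q⁺ : v ∈ p → v ∈ q → v ∈ p ∩ q
  x∈p∩q⁺ = cong₂ _∧_

  x∈p∩q⁻ : v ∈ p ∩ q → v ∈ p × v ∈ q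
  x∈p∩q⁻ v∈ = ∧-conicalˡ (p v) (q v) v∈ , ∧-conicalʳ (p v) (q v) v∈

  x∈p∖q⁺ : v ∈ p → v ∉ q → v ∈ p ∖ q
  x∈p∖q⁺ v∈p v∉q = cong₂ (λ a b → a ∧ not b) v∈p v∉q

  x∈p∖q⁻ : v ∈ p ∖ q → v ∈ p × v ∉ q
  x∈p∖q⁻ v∈ = ∧-conicalˡ (p v) _ v∈ , not-injective {y = false} (∧-conicalʳ (p v) _ v∈)

⊆-antisym : ∀ {n} {p q : VertexSet n} → p ⊆ q → q ⊆ p → p ≗ q
⊆-antisym {p = p} {q} p⊆q q⊆p v with p v in pv | q v in qv
... | true  | true  = refl
... | false | false = refl
... | true  | false = trans (sym (p⊆q v pv)) qv
... | false | true  = trans (sym pv) (q⊆p v qv)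

⊆-or-new : ∀ {n} (p q : VertexSet n) → p ⊆ q ⊎ ∃ λ v → v ∈ p × v ∉ q
⊆-or-new p q with any? (λ v → (p ∖ q) v ≟ᴮ true)
... | yes (v , v∈p∖q) = inj₂ (v , x∈p∖q⁻ {p = p} {q} v∈p∖q)
... | no ∄            = inj₁ λ v v∈p → ¬-not λ v∉q → ∄ (v , x∈p∖q⁺ {p = p} {q} v∈p v∉q)

sum-allFin : ∀ {n} (f : Fin n → ℕ) → sum (map f (allFin n)) ≡ ∑[ i < n ] f i
sum-allFin f = trans (cong sum (map-tabulate id f)) (sum-tabulate f)
  where
  sum-tabulate : ∀ {m} (f : Fin m → ℕ) → sum (tabulate f) ≡ ∑[ i < m ] f i
  sum-tabulate {zero}  f = refl
  sum-tabulate {suc m} f = cong (f zero +_) (sum-tabulate (f ∘ suc))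

count≡∣∣ : ∀ {n} (p : VertexSet n) → count p ≡ ∣ p ∣
count≡∣∣ p = sum-allFin (𝟙 ∘ p)

∣∣-cong : ∀ {n} {p q : VertexSet n} → p ≗ q → ∣ p ∣ ≡ ∣ q ∣
∣∣-cong p≗q = sum-cong-≗ (cong 𝟙 ∘ p≗q)

∣∅∣≡0 : ∀ {n} → ∣ ∅ {n} ∣ ≡ 0
∣∅∣≡0 {zero}  = refl
∣∅∣≡0 {suc n} = ∣∅∣≡0 {n}

∣⁅v⁆∣≡1 : ∀ {n} (v : Fin n) → ∣ ⁅ v ⁆ ∣ ≡ 1
∣⁅v⁆∣≡1 {suc n} zero    = cong suc (∣∅∣≡0 {n})
∣⁅v⁆∣≡1 {suc n} (suc v) = ∣⁅v⁆∣≡1 v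

∣p∣≤n : ∀ {n} (p : VertexSet n) → ∣ p ∣ ≤ n
∣p∣≤n {zero}  p = z≤n
∣p∣≤n {suc n} p = +-mono-≤ (𝟙≤1 (p zero)) (∣p∣≤n (p ∘ suc))
  where
  𝟙≤1 : ∀ b → 𝟙 b ≤ 1
  𝟙≤1 true  = ≤-refl
  𝟙≤1 false = z≤n

𝟙-mono : ∀ {a b} → (a ≡ true → b ≡ true) → 𝟙 a ≤ 𝟙 b
𝟙-mono {true}  a⇒b rewrite a⇒b refl = ≤-refl
𝟙-mono {false} _ = z≤n

p⊆q⇒∣p∣≤∣q∣ : ∀ {n} {p q : VertexSet n} → p ⊆ q → ∣ p ∣ ≤ ∣ q ∣
p⊆q⇒∣p∣≤∣q∣ {zero}  _   = z≤n
p⊆q⇒∣p∣≤∣q∣ {suc n} p⊆q = +-mono-≤ (𝟙-mono (p⊆q zero)) (p⊆q⇒∣p∣≤∣q∣ (p⊆q ∘ suc))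

p⊂q⇒∣p∣<∣q∣ : ∀ {n} {p q : VertexSet n} {v} → p ⊆ q → v ∈ q → v ∉ p → ∣ p ∣ < ∣ q ∣
p⊂q⇒∣p∣<∣q∣ {suc n} {p} {q} {zero} p⊆q v∈q v∉p rewrite v∈q | v∉p =
  s≤s (p⊆q⇒∣p∣≤∣q∣ (p⊆q ∘ suc))
p⊂q⇒∣p∣<∣q∣ {suc n} {v = suc v} p⊆q v∈q v∉p =
  +-mono-≤-< (𝟙-mono (p⊆q zero)) (p⊂q⇒∣p∣<∣q∣ (p⊆q ∘ suc) v∈q v∉p)

∣p∣≡∣p∩q∣+∣p∖q∣ : ∀ {n} (p q : VertexSet n) → ∣ p ∣ ≡ ∣ p ∩ q ∣ + ∣ p ∖ q ∣
∣p∣≡∣p∩q∣+∣p∖q∣ p q =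
  trans (sum-cong-≗ (λ v → 𝟙-split (p v) (q v))) (∑-distrib-+ (𝟙 ∘ (p ∩ q)) (𝟙 ∘ (p ∖ q)))
  where
  𝟙-split : ∀ a b → 𝟙 a ≡ 𝟙 (a ∧ b) + 𝟙 (a ∧ not b)
  𝟙-split true  true  = refl
  𝟙-split true  false = refl
  𝟙-split false _     = refl

∣p∣+∣∁p∣≡n : ∀ {n} (p : VertexSet n) → ∣ p ∣ + ∣ ∁ p ∣ ≡ n
∣p∣+∣∁p∣≡n {n} p = trans (sym (∑-distrib-+ (𝟙 ∘ p) (𝟙 ∘ ∁ p)))
  (trans (sum-cong-≗ (𝟙-excluded-middle ∘ p)) (∑1≡n n))
  where
  𝟙-excluded-middle : ∀ b → 𝟙 b + 𝟙 (not b) ≡ 1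
  𝟙-excluded-middle true  = refl
  𝟙-excluded-middle false = refl
  ∑1≡n : ∀ m → ∑[ i < m ] 1 ≡ m
  ∑1≡n zero    = refl
  ∑1≡n (suc m) = cong suc (∑1≡n m)

∣p∪q∣≤∣p∣+∣q∣ : ∀ {n} (p q : VertexSet n) → ∣ p ∪ q ∣ ≤ ∣ p ∣ + ∣ q ∣
∣p∪q∣≤∣p∣+∣q∣ {zero}  p q = z≤n
∣p∪q∣≤∣p∣+∣q∣ {suc n} p q = begin
  𝟙 (p zero ∨ q zero) + ∣ (p ∪ q) ∘ suc ∣
    ≤⟨ +-mono-≤ (𝟙-∨ (p zero) (q zero)) (∣p∪q∣≤∣p∣+∣q∣ (p ∘ suc) (q ∘ suc)) ⟩
  (𝟙 (p zero) + 𝟙 (q zero)) + (∣ p ∘ suc ∣ + ∣ q ∘ suc ∣)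
    ≡⟨ interchange (𝟙 (p zero)) (𝟙 (q zero)) ∣ p ∘ suc ∣ ∣ q ∘ suc ∣ ⟩
  ∣ p ∣ + ∣ q ∣ ∎
  where
  open ≤-Reasoning
  𝟙-∨ : ∀ a b → 𝟙 (a ∨ b) ≤ 𝟙 a + 𝟙 b
  𝟙-∨ true  _ = s≤s z≤n
  𝟙-∨ false _ = ≤-refl

∣p∣>0⇒∃∈p : ∀ {n} (p : VertexSet n) → 0 < ∣ p ∣ → ∃ λ v → v ∈ p
∣p∣>0⇒∃∈p {suc n} p ∣p∣>0 with p zero in p0
... | true  = zero , p0
... | false with ∣p∣>0⇒∃∈p (p ∘ suc) ∣p∣>0
...   | v , v∈p = suc v , v∈p

∃⊆-of-size : ∀ {n} (p : VertexSet n) k → k ≤ ∣ p ∣ → ∃ λ q → q ⊆ p × ∣ q ∣ ≡ k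
∃⊆-of-size {n} p zero _ = ∅ , (λ _ ()) , ∣∅∣≡0 {n}
∃⊆-of-size {suc n} p (suc k) k<∣p∣ with p zero in p0
... | true with ∃⊆-of-size (p ∘ suc) k (≤-pred k<∣p∣)
...   | q , q⊆p , ∣q∣≡k = (true ∷ q) , (λ { zero _ → p0 ; (suc v) → q⊆p v }) , cong suc ∣q∣≡k
∃⊆-of-size {suc n} p (suc k) k<∣p∣ | false with ∃⊆-of-size (p ∘ suc) (suc k) k<∣p∣
...   | q , q⊆p , ∣q∣≡k = (false ∷ q) , (λ { zero () ; (suc v) → q⊆p v }) , ∣q∣≡k

N⁻ : ∀ {n} → ArcSet n → Fin n → VertexSet n
N⁻ A v u = A u v

arcCount≡∑∣N⁻∣ : ∀ {n} (A : ArcSet n) → arcCount A ≡ ∑[ v < n ] ∣ N⁻ A v ∣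
arcCount≡∑∣N⁻∣ {n} A = begin
  arcCount A                        ≡⟨ sum-allFin (outdeg A) ⟩
  ∑[ u < n ] count (A u)            ≡⟨ sum-cong-≗ (count≡∣∣ ∘ A) ⟩
  ∑[ u < n ] ∑[ v < n ] 𝟙 (A u v)   ≡⟨ ∑-comm (λ u v → 𝟙 (A u v)) ⟩
  ∑[ v < n ] ∣ N⁻ A v ∣             ∎
  where open ≡-Reasoning

module _ {n} {T : ArcSet n} where

  infixr 5 _++ʷ_

  _++ʷ_ : ∀ {u v w} → UWalk T u v → UWalk T v w → UWalk T u w
  here    ++ʷ q = q
  fwd a p ++ʷ q = fwd a (p ++ʷ q)
  bwd a p ++ʷ q = bwd a (p ++ʷ q)

  reverseʷ : ∀ {u v} → UWalk T u v → UWalk T v u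
  reverseʷ here      = here
  reverseʷ (fwd a p) = reverseʷ p ++ʷ bwd a here
  reverseʷ (bwd a p) = reverseʷ p ++ʷ fwd a here

HasParentsIn : ∀ {n} → ArcSet n → VertexSet n → (Fin n → ℕ) → Fin n → Set
HasParentsIn A I rank r = ∀ v → v ≢ r → ∃ λ u → u ∈ I × A u v ≡ true × rank u < rank v

ArborescenceWithin : (G : Digraph) → VertexSet (n G) → ArcSet (n G) → Set
ArborescenceWithin G I T =
  IsSpanningArborescence G T × (∀ u v → T u v ≡ true → u ∈ I) × (∀ v → Interior T v → v ∈ I)

arcCount-of-indeg : ∀ {n} (T : ArcSet n) r → ∣ N⁻ T r ∣ ≡ 0 → (∀ v → v ≢ r → ∣ N⁻ T v ∣ ≡ 1) →
                    arcCount T + 1 ≡ n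
arcCount-of-indeg {n} T r root other = begin
  arcCount T + 1                        ≡⟨ cong₂ _+_ (arcCount≡∑∣N⁻∣ T) (sym (∣⁅v⁆∣≡1 r)) ⟩
  ∑[ v < n ] ∣ N⁻ T v ∣ + ∣ ⁅ r ⁆ ∣     ≡⟨ cong (_+ ∣ ⁅ r ⁆ ∣) (sum-cong-≗ indeg≡𝟙) ⟩
  ∣ ∁ ⁅ r ⁆ ∣ + ∣ ⁅ r ⁆ ∣               ≡⟨ +-comm (∣ ∁ ⁅ r ⁆ ∣) (∣ ⁅ r ⁆ ∣) ⟩
  ∣ ⁅ r ⁆ ∣ + ∣ ∁ ⁅ r ⁆ ∣               ≡⟨ ∣p∣+∣∁p∣≡n ⁅ r ⁆ ⟩
  n                                     ∎
  where
  open ≡-Reasoning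
  indeg≡𝟙 : ∀ v → ∣ N⁻ T v ∣ ≡ 𝟙 (∁ ⁅ r ⁆ v)
  indeg≡𝟙 v with v ≟ r
  ... | yes refl = root
  ... | no v≢r   = other v v≢r

module ParentTree {n} (A : ArcSet n) (r : Fin n) (I : VertexSet n) (rank : Fin n → ℕ)
                  (parents : HasParentsIn A I rank r) where

  Parent : Fin n → Fin n → Set
  Parent v u = u ∈ I × A u v ≡ true × rank u < rank v

  parent? : ∀ v u → Dec (Parent v u)
  parent? v u = (I u ≟ᴮ true) ×-dec (A u v ≟ᴮ true) ×-dec (rank u <? rank v)

  parent : Fin n → Fin n
  parent v with any? (parent? v)
  ... | yes (u , _) = u
  ... | no _        = r

  parent-spec : ∀ v → v ≢ r → Parent v (parent v)
  parent-spec v v≢r with any? (parent? v)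
  ... | yes (_ , pu) = pu
  ... | no ∄         = contradiction (parents v v≢r) ∄

  T : ArcSet n
  T u v = not (does (v ≟ r)) ∧ does (u ≟ parent v)

  T-inv : ∀ {u v} → T u v ≡ true → v ≢ r × u ≡ parent v
  T-inv {u} {v} _ with v ≟ r | u ≟ parent v
  ... | no v≢r | yes u≡p = v≢r , u≡p

  T-parent : ∀ v → v ≢ r → T (parent v) v ≡ true
  T-parent v v≢r rewrite dec-false (v ≟ r) v≢r = dec-true (parent v ≟ parent v) refl

  T⊆A : T ⊆ᴬ A
  T⊆A u v uv with T-inv {u} {v} uv
  ... | v≢r , refl = proj₁ (proj₂ (parent-spec v v≢r))

  tail∈I : ∀ u v → T u v ≡ true → u ∈ I
  tail∈I u v uv with T-inv {u} {v} uv
  ... | v≢r , refl = proj₁ (parent-spec v v≢r)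

  ∣N⁻r∣≡0 : ∣ N⁻ T r ∣ ≡ 0
  ∣N⁻r∣≡0 rewrite dec-true (r ≟ r) refl = ∣∅∣≡0 {n}

  ∣N⁻v∣≡1 : ∀ v → v ≢ r → ∣ N⁻ T v ∣ ≡ 1
  ∣N⁻v∣≡1 v v≢r rewrite dec-false (v ≟ r) v≢r = ∣⁅v⁆∣≡1 (parent v)

  indeg-root : indeg T r ≡ 0
  indeg-root = trans (count≡∣∣ (N⁻ T r)) ∣N⁻r∣≡0

  indeg-other : ∀ v → v ≢ r → indeg T v ≡ 1
  indeg-other v v≢r = trans (count≡∣∣ (N⁻ T v)) (∣N⁻v∣≡1 v v≢r)

  to-root : ∀ v → Acc _<_ (rank v) → UWalk T v r
  to-root v (acc rs) with v ≟ r
  ... | yes refl = here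
  ... | no v≢r   = bwd (T-parent v v≢r) (to-root (parent v) (rs parent<v))
    where
    parent<v : rank (parent v) < rank v
    parent<v = proj₂ (proj₂ (parent-spec v v≢r))

  connected : ∀ u v → UWalk T u v
  connected u v = to-root u (<-wellFounded _) ++ʷ reverseʷ (to-root v (<-wellFounded _))

  interior⊆I : r ∈ I → ∀ v → Interior T v → v ∈ I
  interior⊆I r∈I v deg≥2 = by-cases (v ≟ r)
    where
    by-cases : Dec (v ≡ r) → v ∈ I
    by-cases (yes refl) = r∈I
    by-cases (no v≢r) with ∣p∣>0⇒∃∈p (T v) outdeg>0
      where
      outdeg>0 : 0 < ∣ T v ∣
      outdeg>0 = ≤-pred (subst₂ (λ i o → 2 ≤ i + o) (indeg-other v v≢r) (count≡∣∣ (T v)) deg≥2)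
    ... | w , vw = tail∈I v w vw

arborescence-from-parents : (G : Digraph) {r : Fin (n G)} {I : VertexSet (n G)}
                            (rank : Fin (n G) → ℕ) → r ∈ I → HasParentsIn (adj G) I rank r →
                            ∃ (ArborescenceWithin G I)
arborescence-from-parents G {r} {I} rank r∈I parents =
  T , (T⊆A , (connected , arcCount-of-indeg T r ∣N⁻r∣≡0 ∣N⁻v∣≡1) , (r , indeg-root , indeg-other)) ,
  tail∈I , interior⊆I r∈I
  where open ParentTree (adj G) r I rank parents

cisa-from-complementary : (G : Digraph) (I : VertexSet (n G)) →
                          ∃ (ArborescenceWithin G I) → ∃ (ArborescenceWithin G (∁ I)) → HasCISA2 G
cisa-from-complementary G I (T₁ , arb₁ , tail₁ , int₁) (T₂ , arb₂ , tail₂ , int₂) =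
  T₁ , T₂ , arb₁ , arb₂ ,
  (λ v (i₁ , i₂) → complementary v (int₁ v i₁) (int₂ v i₂)) ,
  (λ u v (a₁ , a₂) → complementary u (tail₁ u v a₁) (tail₂ u v a₂))
  where
  complementary : ∀ v → v ∈ I → v ∈ ∁ I → ⊥
  complementary v v∈I v∈∁I rewrite v∈I = case v∈∁I of λ ()

Increasing : (ℕ → Bool) → Set
Increasing f = ∀ {s t} → s ≤ t → f s ≡ true → f t ≡ true

-- For increasing f, the least t < m with f t ≡ true (or m if there is none).
entryTime : ℕ → (ℕ → Bool) → ℕ
entryTime zero    f = 0
entryTime (suc m) f = entryTime m f + 𝟙 (not (f m))

entryTime≤m : ∀ m f → entryTime m f ≤ m
entryTime≤m zero    f = z≤n
entryTime≤m (suc m) f with f m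
... | true  = ≤-trans (≤-reflexive (+-identityʳ _)) (m≤n⇒m≤1+n (entryTime≤m m f))
... | false = ≤-trans (≤-reflexive (+-comm _ 1)) (s≤s (entryTime≤m m f))

entryTime≤ : ∀ {f} → Increasing f → ∀ {t} → f t ≡ true → ∀ m → entryTime m f ≤ t
entryTime≤ inc ft zero = z≤n
entryTime≤ {f} inc {t} ft (suc m) with t ≤? m
... | yes t≤m rewrite inc t≤m ft | +-identityʳ (entryTime m f) = entryTime≤ inc ft m
... | no  t≰m = ≤-trans (entryTime≤m (suc m) f) (≰⇒> t≰m)

entryTime> : ∀ {f} → Increasing f → ∀ {t} → f t ≡ false → ∀ {m} → t < m → t < entryTime m f
entryTime> {f} inc {t} ft {suc m} t<1+m with m≤n⇒m<n∨m≡n (≤-pred t<1+m)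
... | inj₁ t<m  = ≤-trans (entryTime> inc ft t<m) (m≤m+n (entryTime m f) _)
... | inj₂ refl = entry t ft
  where
  entry : ∀ s → f s ≡ false → s < entryTime (suc s) f
  entry zero    fs rewrite fs = ≤-refl
  entry (suc s) fs rewrite fs =
    ≤-trans (≤-reflexive (+-comm 1 _)) (+-monoˡ-≤ 1 (entry s (earlier s fs)))
    where
    earlier : ∀ s → f (suc s) ≡ false → f s ≡ false
    earlier s fs' = ¬-not (λ fs≡true → case trans (sym fs') (inc (n≤1+n s) fs≡true) of λ ())

crossing : ∀ (f : ℕ → Bool) {m} → f 0 ≡ false → f m ≡ true →
           ∃ λ t → t < m × f t ≡ false × f (suc t) ≡ true
crossing f {zero}  f0 fm = case trans (sym f0) fm of λ ()
crossing f {suc m} f0 fm with f m in fm'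
... | false = m , ≤-refl , fm' , fm
... | true  with crossing f f0 fm'
...   | t , t<m , ft , ft+1 = t , m≤n⇒m≤1+n t<m , ft , ft+1

iterate : ∀ {A : Set} → (A → A) → A → ℕ → A
iterate F x zero    = x
iterate F x (suc t) = F (iterate F x t)

module _ {n} (F : VertexSet n → VertexSet n)
         (F-cong : ∀ {p q} → p ≗ q → F p ≗ F q)
         (F-inflationary : ∀ p → p ⊆ F p) (p : VertexSet n) where

  private
    Fixed : ℕ → Set
    Fixed t = iterate F p (suc t) ≗ iterate F p t

    fixed-≤′ : ∀ {s t} → Fixed s → s ≤′ t → Fixed t
    fixed-≤′ fx ≤′-refl         = fx
    fixed-≤′ fx (≤′-step s≤′t) = F-cong (fixed-≤′ fx s≤′t)

    growth : ∀ t → (∃ λ s → s < t × Fixed s) ⊎ t ≤ ∣ iterate F p t ∣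
    growth zero = inj₂ z≤n
    growth (suc t) with growth t
    ... | inj₁ (s , s<t , fx) = inj₁ (s , m≤n⇒m≤1+n s<t , fx)
    ... | inj₂ t≤∣pₜ∣ with ⊆-or-new (iterate F p (suc t)) (iterate F p t)
    ...   | inj₁ pₜ₊₁⊆pₜ = inj₁ (t , ≤-refl , ⊆-antisym pₜ₊₁⊆pₜ (F-inflationary _))
    ...   | inj₂ (v , v∈pₜ₊₁ , v∉pₜ) =
              inj₂ (≤-trans (s≤s t≤∣pₜ∣) (p⊂q⇒∣p∣<∣q∣ (F-inflationary _) v∈pₜ₊₁ v∉pₜ))

  iterate-stable : iterate F p (suc n) ≗ iterate F p n
  iterate-stable with growth (suc n)
  ... | inj₁ (s , s<1+n , fx) = fixed-≤′ fx (≤⇒≤′ (≤-pred s<1+n))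
  ... | inj₂ 1+n≤∣pₙ₊₁∣       = contradiction (∣p∣≤n _) (<⇒≱ 1+n≤∣pₙ₊₁∣)

iterate-increasing : ∀ {n} (F : VertexSet n → VertexSet n) → (∀ p → p ⊆ F p) →
                     ∀ p v → Increasing (λ t → iterate F p t v)
iterate-increasing F F-inflationary p v s≤t = go (≤⇒≤′ s≤t)
  where
  go : ∀ {s t} → s ≤′ t → iterate F p s v ≡ true → iterate F p t v ≡ true
  go ≤′-refl         v∈pₛ = v∈pₛ
  go (≤′-step s≤′t) v∈pₛ = F-inflationary _ v (go s≤′t v∈pₛ)

module Reachability {n} (A : ArcSet n) where

  successors : VertexSet n → VertexSet n
  successors S w = does (any? λ u → (S u ∧ A u w) ≟ᴮ true)

  successors-sound : ∀ {S w} → w ∈ successors S → ∃ λ u → u ∈ S × A u w ≡ true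
  successors-sound {S} {w} w∈ with does-true (any? (λ u → (S u ∧ A u w) ≟ᴮ true)) w∈
  ... | u , e = u , x∈p∩q⁻ {p = S} {N⁻ A w} e

  successors-complete : ∀ {S u w} → u ∈ S → A u w ≡ true → w ∈ successors S
  successors-complete {S} {u} {w} u∈S uw =
    dec-true (any? λ u → (S u ∧ A u w) ≟ᴮ true) (u , cong₂ _∧_ u∈S uw)

  successors-cong : ∀ {S S'} → S ≗ S' → successors S ≗ successors S'
  successors-cong {S} {S'} S≗S' w =
    does-⇔ (mk⇔ (transport S≗S') (transport {S'} {S} (sym ∘ S≗S')))
           (any? (λ u → (S u ∧ A u w) ≟ᴮ true)) (any? (λ u → (S' u ∧ A u w) ≟ᴮ true))
    where
    transport : ∀ {p q} → p ≗ q →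
                (∃ λ u → (p u ∧ A u w) ≡ true) → ∃ λ u → (q u ∧ A u w) ≡ true
    transport p≗q (u , e) = u , trans (cong (_∧ A u w) (sym (p≗q u))) e

  module _ (M : VertexSet n) where

    step : VertexSet n → VertexSet n
    step S = S ∪ M ∩ successors S

    step-inflationary : ∀ S → S ⊆ step S
    step-inflationary S v v∈S rewrite v∈S = refl

    step-cong : ∀ {S S'} → S ≗ S' → step S ≗ step S'
    step-cong S≗S' w = cong₂ _∨_ (S≗S' w) (cong (M w ∧_) (successors-cong S≗S' w))

    -- layer c t: the vertices reachable from c by a walk of length ≤ t whose vertices after c
    -- all lie in M.
    layer : Fin n → ℕ → VertexSet n
    layer c = iterate step ⁅ c ⁆

    reach : Fin n → VertexSet n
    reach c = layer c n

    step-successors : ∀ {S w} → w ∈ M → w ∈ successors S → w ∈ step S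
    step-successors {S} {w} w∈M w∈succ rewrite w∈M | w∈succ = ∨-zeroʳ (S w)

    layer-increasing : ∀ c v → Increasing (λ t → layer c t v)
    layer-increasing c = iterate-increasing step step-inflationary ⁅ c ⁆

    layer-stable : ∀ c → layer c (suc n) ≗ reach c
    layer-stable c = iterate-stable step step-cong step-inflationary ⁅ c ⁆

    c∈reach : ∀ c → c ∈ reach c
    c∈reach c = layer-increasing c c {t = n} z≤n (u∈⁅u⁆ c)

    reach-closed : ∀ {c u w} → u ∈ reach c → A u w ≡ true → w ∈ M → w ∈ reach c
    reach-closed {c} {w = w} u∈ uw w∈M =
      trans (sym (layer-stable c w)) (step-successors w∈M (successors-complete u∈ uw))

    layer-new : ∀ {c t w} → w ∈ layer c (suc t) → w ∉ layer c t →
                ∃ λ u → u ∈ layer c t × A u w ≡ true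
    layer-new {w = w} w∈ w∉ rewrite w∉ = successors-sound (∧-conicalʳ (M w) _ w∈)

    reach-least : ∀ {c} (P : VertexSet n) → c ∈ P →
                  (∀ {u w} → u ∈ P → A u w ≡ true → w ∈ M → w ∈ P) → reach c ⊆ P
    reach-least {c} P c∈P closed = layer⊆P n
      where
      layer⊆P : ∀ t → layer c t ⊆ P
      layer⊆P zero    w w∈⁅c⁆ = subst (_∈ P) (sym (∈⁅⁆⇒≡ w∈⁅c⁆)) c∈P
      layer⊆P (suc t) w w∈ with layer c t w in w∈ₜ
      ... | true  = layer⊆P t w w∈ₜ
      ... | false with successors-sound (∧-conicalʳ (M w) _ w∈)
      ...   | u , u∈ , uw = closed (layer⊆P t u u∈) uw (∧-conicalˡ (M w) _ w∈)

  reach-trans : ∀ {M c z w} → z ∈ reach M c → w ∈ reach M z → w ∈ reach M c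
  reach-trans {M} {c} z∈ = reach-least M (reach M c) z∈ (reach-closed M) _

  reach-mono : ∀ {M M' c} → M' ⊆ M → reach M' c ⊆ reach M c
  reach-mono {M} {M'} {c} M'⊆M =
    reach-least M' (reach M c) (c∈reach M c) (λ u∈ uw w∈M' → reach-closed M u∈ uw (M'⊆M _ w∈M'))

  reach⊆⁅c⁆∪M : ∀ {M c} → reach M c ⊆ ⁅ c ⁆ ∪ M
  reach⊆⁅c⁆∪M {M} {c} = reach-least M (⁅ c ⁆ ∪ M) (cong (_∨ M c) (u∈⁅u⁆ c))
                          (λ {_} {w} _ _ w∈M → trans (cong (⁅ c ⁆ w ∨_) w∈M) (∨-zeroʳ _))

module Centres {n} (A : ArcSet n) (loopless : ∀ v → A v v ≡ false) (K : VertexSet n) where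

  open Reachability A

  centres : VertexSet n → VertexSet n
  centres M c = K c ∧ does (M ⊆? reach M c)

  centres⁺ : ∀ {M c} → c ∈ K → M ⊆ reach M c → c ∈ centres M
  centres⁺ {M} {c} c∈K M⊆ = cong₂ _∧_ c∈K (dec-true (M ⊆? reach M c) M⊆)

  centres⁻ : ∀ {M c} → c ∈ centres M → c ∈ K × M ⊆ reach M c
  centres⁻ {M} {c} c∈ = ∧-conicalˡ (K c) _ c∈ , does-true (M ⊆? reach M c) (∧-conicalʳ (K c) _ c∈)

  MissBound : VertexSet n → Set
  MissBound M = ∀ w → w ∈ M → ∣ K ∖ N⁻ A w ∣ ≤ 1 + ∣ M ∩ N⁻ A w ∣

  module Split (M : VertexSet n) (z : Fin n) (z∈M : z ∈ M) where

    Z M' : VertexSet n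
    Z  = M ∩ reach M z
    M' = M ∖ reach M z

    ∣M∣≡∣Z∣+∣M'∣ : ∣ M ∣ ≡ ∣ Z ∣ + ∣ M' ∣
    ∣M∣≡∣Z∣+∣M'∣ = ∣p∣≡∣p∩q∣+∣p∖q∣ M (reach M z)

    M'⊆M : M' ⊆ M
    M'⊆M v v∈M' = proj₁ (x∈p∖q⁻ {p = M} {reach M z} v∈M')

    ∣M'∣<∣M∣ : ∣ M' ∣ < ∣ M ∣
    ∣M'∣<∣M∣ = p⊂q⇒∣p∣<∣q∣ M'⊆M z∈M z∉M'
      where
      z∉M' : z ∉ M'
      z∉M' rewrite z∈M | c∈reach M z = refl

    missBound' : MissBound M → MissBound M'
    missBound' bound w w∈M' = ≤-trans (bound w (M'⊆M w w∈M')) (s≤s (p⊆q⇒∣p∣≤∣q∣ in-nbrs⊆))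
      where
      in-nbrs⊆ : M ∩ N⁻ A w ⊆ M' ∩ N⁻ A w
      in-nbrs⊆ u u∈ with x∈p∩q⁻ {p = M} {N⁻ A w} u∈ | x∈p∖q⁻ {p = M} {reach M z} w∈M'
      ... | u∈M , uw | w∈M , w∉R =
        x∈p∩q⁺ {p = M'} {N⁻ A w} (x∈p∖q⁺ {p = M} {reach M z} u∈M (¬-not u∉R)) uw
        where
        u∉R : u ∈ reach M z → ⊥
        u∉R u∈R = case trans (sym w∉R) (reach-closed M u∈R uw w∈M) of λ ()

    lift : ∀ {c} → c ∈ centres M' → z ∈ reach M c → c ∈ centres M
    lift {c} c∈ z∈ = centres⁺ (proj₁ (centres⁻ c∈)) M⊆
      where
      M⊆ : M ⊆ reach M c
      M⊆ w w∈M with reach M z w in w∈R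
      ... | true  = reach-trans z∈ w∈R
      ... | false = reach-mono M'⊆M w (proj₂ (centres⁻ c∈) w (x∈p∖q⁺ {p = M} {reach M z} w∈M w∈R))

    induction-step : MissBound M → ∣ K ∣ ≤ ∣ centres M' ∣ + ∣ M' ∣ → ∣ K ∣ ≤ ∣ centres M ∣ + ∣ M ∣
    induction-step bound IH with any? (λ x → (M' x ∧ A x z) ≟ᴮ true)
    ... | yes (x , x∈) with x∈p∩q⁻ {p = M'} {N⁻ A z} x∈
    ...   | x∈M' , xz = ≤-trans IH (+-mono-≤ (p⊆q⇒∣p∣≤∣q∣ centres'⊆centres) (<⇒≤ ∣M'∣<∣M∣))
      where
      centres'⊆centres : centres M' ⊆ centres M
      centres'⊆centres c c∈ =
        lift c∈ (reach-closed M (reach-mono M'⊆M x (proj₂ (centres⁻ c∈) x x∈M')) xz z∈M)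
    induction-step bound IH | no ∄ = begin
      ∣ K ∣
        ≤⟨ IH ⟩
      ∣ centres M' ∣ + ∣ M' ∣
        ≡⟨ cong (_+ ∣ M' ∣) (∣p∣≡∣p∩q∣+∣p∖q∣ (centres M') (N⁻ A z)) ⟩
      ∣ centres M' ∩ N⁻ A z ∣ + ∣ centres M' ∖ N⁻ A z ∣ + ∣ M' ∣
        ≤⟨ +-monoˡ-≤ ∣ M' ∣ (+-mono-≤ (p⊆q⇒∣p∣≤∣q∣ adjacent) (p⊆q⇒∣p∣≤∣q∣ non-adjacent)) ⟩
      ∣ centres M ∣ + ∣ K ∖ N⁻ A z ∣ + ∣ M' ∣
        ≤⟨ +-monoˡ-≤ ∣ M' ∣ (+-monoʳ-≤ ∣ centres M ∣ (≤-trans (bound z z∈M) in-nbrs<∣Z∣)) ⟩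
      ∣ centres M ∣ + ∣ Z ∣ + ∣ M' ∣
        ≡⟨ +-assoc (∣ centres M ∣) (∣ Z ∣) (∣ M' ∣) ⟩
      ∣ centres M ∣ + (∣ Z ∣ + ∣ M' ∣)
        ≡⟨ cong (∣ centres M ∣ +_) (sym ∣M∣≡∣Z∣+∣M'∣) ⟩
      ∣ centres M ∣ + ∣ M ∣
        ∎
      where
      open ≤-Reasoning

      adjacent : centres M' ∩ N⁻ A z ⊆ centres M
      adjacent c c∈ with x∈p∩q⁻ {p = centres M'} {N⁻ A z} c∈
      ... | c∈centres' , cz = lift c∈centres' (reach-closed M (c∈reach M c) cz z∈M)

      non-adjacent : centres M' ∖ N⁻ A z ⊆ K ∖ N⁻ A z
      non-adjacent c c∈ with x∈p∖q⁻ {p = centres M'} {N⁻ A z} c∈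
      ... | c∈centres' , ¬cz = x∈p∖q⁺ {p = K} {N⁻ A z} (proj₁ (centres⁻ c∈centres')) ¬cz

      in-nbrs⊆Z : M ∩ N⁻ A z ⊆ Z
      in-nbrs⊆Z u u∈ with x∈p∩q⁻ {p = M} {N⁻ A z} u∈
      ... | u∈M , uz = x∈p∩q⁺ {p = M} {reach M z} u∈M (¬-not ¬u∉R)
        where
        ¬u∉R : reach M z u ≢ false
        ¬u∉R u∉R = ∄ (u , x∈p∩q⁺ {p = M'} {N⁻ A z} (x∈p∖q⁺ {p = M} {reach M z} u∈M u∉R) uz)

      in-nbrs<∣Z∣ : 1 + ∣ M ∩ N⁻ A z ∣ ≤ ∣ Z ∣
      in-nbrs<∣Z∣ = p⊂q⇒∣p∣<∣q∣ in-nbrs⊆Z (x∈p∩q⁺ {p = M} {reach M z} z∈M (c∈reach M z)) z∉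
        where
        z∉ : z ∉ M ∩ N⁻ A z
        z∉ rewrite loopless z = ∧-zeroʳ (M z)

  -- Induction on ∣ M ∣: remove from M the set Z of vertices that some z ∈ M reaches inside M.
  -- If a vertex of M ∖ Z has an arc to z, every centre for M ∖ Z is a centre for M.  Otherwise
  -- all in-neighbours of z in M lie in Z ∖ {z}, and MissBound at z pays for the centres lost.
  ∣K∣≤∣centres∣+∣M∣ : ∀ M → MissBound M → ∣ K ∣ ≤ ∣ centres M ∣ + ∣ M ∣
  ∣K∣≤∣centres∣+∣M∣ M = go M (<-wellFounded ∣ M ∣)
    where
    go : ∀ M → Acc _<_ ∣ M ∣ → MissBound M → ∣ K ∣ ≤ ∣ centres M ∣ + ∣ M ∣
    go M (acc rs) bound with any? (λ z → M z ≟ᴮ true)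
    ... | no ∄ = ≤-trans (p⊆q⇒∣p∣≤∣q∣ K⊆centres) (m≤m+n (∣ centres M ∣) (∣ M ∣))
      where
      K⊆centres : K ⊆ centres M
      K⊆centres c c∈K = centres⁺ c∈K λ w w∈M → ⊥-elim (∄ (w , w∈M))
    ... | yes (z , z∈M) = induction-step bound (go M' (rs ∣M'∣<∣M∣) (missBound' bound))
      where open Split M z z∈M

∃-in-neighbour-outside : ∀ {n} {A : ArcSet n} → (∀ v → A v v ≡ false) → ∀ {S v} →
                         v ∈ S → ∣ S ∣ ≤ ∣ N⁻ A v ∣ → ∃ λ u → u ∉ S × A u v ≡ true
∃-in-neighbour-outside {A = A} loopless {S} {v} v∈S ∣S∣≤d⁻
  with ∣p∣>0⇒∃∈p (N⁻ A v ∖ S) 0<outside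
  where
  inside<∣S∣ : ∣ N⁻ A v ∩ S ∣ < ∣ S ∣
  inside<∣S∣ = p⊂q⇒∣p∣<∣q∣ {p = N⁻ A v ∩ S} {S} (λ u u∈ → proj₂ (x∈p∩q⁻ {p = N⁻ A v} {S} u∈)) v∈S
                 (cong (_∧ S v) (loopless v))
  0<outside : 0 < ∣ N⁻ A v ∖ S ∣
  0<outside = +-cancelˡ-< (∣ N⁻ A v ∩ S ∣) 0 _ (begin-strict
    ∣ N⁻ A v ∩ S ∣ + 0            ≡⟨ +-identityʳ _ ⟩
    ∣ N⁻ A v ∩ S ∣                <⟨ ≤-trans inside<∣S∣ ∣S∣≤d⁻ ⟩
    ∣ N⁻ A v ∣                    ≡⟨ ∣p∣≡∣p∩q∣+∣p∖q∣ (N⁻ A v) S ⟩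
    ∣ N⁻ A v ∩ S ∣ + ∣ N⁻ A v ∖ S ∣ ∎)
    where open ≤-Reasoning
... | u , u∈ with x∈p∖q⁻ {p = N⁻ A v} {S} u∈
...   | uv , u∉S = u , u∉S , uv

n≤2⌈n/2⌉ : ∀ n → n ≤ ⌈ n /2⌉ + ⌈ n /2⌉
n≤2⌈n/2⌉ n = subst (_≤ ⌈ n /2⌉ + ⌈ n /2⌉) (⌊n/2⌋+⌈n/2⌉≡n n) (+-monoˡ-≤ ⌈ n /2⌉ (⌊n/2⌋≤⌈n/2⌉ n))

⌈n/2⌉≤d : ∀ {n d} → n ≤ 2 * d → ⌈ n /2⌉ ≤ d
⌈n/2⌉≤d {n} {d} n≤2d =
  subst (⌈ n /2⌉ ≤_) (⌈d+d/2⌉≡d d) (⌈n/2⌉-mono (subst (n ≤_) (cong (d +_) (+-identityʳ d)) n≤2d))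
  where
  ⌈d+d/2⌉≡d : ∀ d → ⌈ d + d /2⌉ ≡ d
  ⌈d+d/2⌉≡d zero = refl
  ⌈d+d/2⌉≡d (suc d) rewrite +-suc d d = cong suc (⌈d+d/2⌉≡d d)

module HalfSemidegree (G : Digraph) (δ⁰ : MinSemidegreeAtLeastHalf G) where

  k : ℕ
  k = ⌈ n G /2⌉

  k≤d⁺ : ∀ v → k ≤ ∣ adj G v ∣
  k≤d⁺ v = ⌈n/2⌉≤d (subst (λ d → n G ≤ 2 * d) (count≡∣∣ (adj G v)) (proj₁ (δ⁰ v)))

  k≤d⁻ : ∀ v → k ≤ ∣ N⁻ (adj G) v ∣
  k≤d⁻ v = ⌈n/2⌉≤d (subst (λ d → n G ≤ 2 * d) (count≡∣∣ (N⁻ (adj G) v)) (proj₂ (δ⁰ v)))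

  in-neighbour-outside : ∀ {S v} → v ∈ S → ∣ S ∣ ≤ k → ∃ λ u → u ∉ S × adj G u v ≡ true
  in-neighbour-outside v∈S ∣S∣≤k = ∃-in-neighbour-outside (loopless G) v∈S (≤-trans ∣S∣≤k (k≤d⁻ _))

  module WithRoot (a : Fin (n G)) (K : VertexSet (n G)) (K⊆N⁺a : K ⊆ adj G a) (∣K∣≡k : ∣ K ∣ ≡ k)
                  where

    open Reachability (adj G)
    open Centres (adj G) (loopless G) K using (centres; centres⁻; MissBound; ∣K∣≤∣centres∣+∣M∣)

    M : VertexSet (n G)
    M = ∁ (⁅ a ⁆ ∪ K)

    a∉K : a ∉ K
    a∉K = ¬-not λ a∈K → case trans (sym (loopless G a)) (K⊆N⁺a a a∈K) of λ ()

    k<∣⁅a⁆∪K∣ : k < ∣ ⁅ a ⁆ ∪ K ∣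
    k<∣⁅a⁆∪K∣ = subst (_< ∣ ⁅ a ⁆ ∪ K ∣) ∣K∣≡k
      (p⊂q⇒∣p∣<∣q∣ {p = K} {⁅ a ⁆ ∪ K} (λ v v∈K → trans (cong (⁅ a ⁆ v ∨_) v∈K) (∨-zeroʳ _))
                   (cong (_∨ K a) (u∈⁅u⁆ a)) a∉K)

    ∣M∣<k : ∣ M ∣ < k
    ∣M∣<k = +-cancelʳ-≤ k (suc ∣ M ∣) k (begin
      suc ∣ M ∣ + k            ≡⟨ +-comm (suc ∣ M ∣) k ⟩
      k + suc ∣ M ∣            ≡⟨ +-suc k ∣ M ∣ ⟩
      suc k + ∣ M ∣            ≤⟨ +-monoˡ-≤ ∣ M ∣ k<∣⁅a⁆∪K∣ ⟩
      ∣ ⁅ a ⁆ ∪ K ∣ + ∣ M ∣    ≡⟨ ∣p∣+∣∁p∣≡n (⁅ a ⁆ ∪ K) ⟩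
      n G                      ≤⟨ n≤2⌈n/2⌉ (n G) ⟩
      k + k                    ∎)
      where open ≤-Reasoning

    missBound : MissBound M
    missBound w _ = +-cancelˡ-≤ ∣ K ∩ P ∣ _ _ (begin
      ∣ K ∩ P ∣ + ∣ K ∖ P ∣               ≡⟨ sym (∣p∣≡∣p∩q∣+∣p∖q∣ K P) ⟩
      ∣ K ∣                               ≡⟨ ∣K∣≡k ⟩
      k                                   ≤⟨ k≤d⁻ w ⟩
      ∣ P ∣                               ≤⟨ p⊆q⇒∣p∣≤∣q∣ cover ⟩
      ∣ ⁅ a ⁆ ∪ (K ∩ P ∪ M ∩ P) ∣         ≤⟨ ∣p∪q∣≤∣p∣+∣q∣ ⁅ a ⁆ (K ∩ P ∪ M ∩ P) ⟩
      ∣ ⁅ a ⁆ ∣ + ∣ K ∩ P ∪ M ∩ P ∣       ≤⟨ +-mono-≤ (≤-reflexive (∣⁅v⁆∣≡1 a))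
                                                       (∣p∪q∣≤∣p∣+∣q∣ (K ∩ P) (M ∩ P)) ⟩
      1 + (∣ K ∩ P ∣ + ∣ M ∩ P ∣)         ≡⟨ sym (+-suc ∣ K ∩ P ∣ ∣ M ∩ P ∣) ⟩
      ∣ K ∩ P ∣ + (1 + ∣ M ∩ P ∣)         ∎)
      where
      open ≤-Reasoning
      P : VertexSet (n G)
      P = N⁻ (adj G) w
      cover : P ⊆ ⁅ a ⁆ ∪ (K ∩ P ∪ M ∩ P)
      cover u uw rewrite uw with ⁅ a ⁆ u | K u
      ... | true  | _     = refl
      ... | false | true  = refl
      ... | false | false = refl

    ∃-centre : ∃ λ c → c ∈ K × M ⊆ reach M c
    ∃-centre with ∣p∣>0⇒∃∈p (centres M) 0<∣centres∣
      where
      0<∣centres∣ : 0 < ∣ centres M ∣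
      0<∣centres∣ = +-cancelʳ-≤ (∣ M ∣) 1 (∣ centres M ∣)
        (≤-trans ∣M∣<k (subst (_≤ ∣ centres M ∣ + ∣ M ∣) ∣K∣≡k (∣K∣≤∣centres∣+∣M∣ M missBound)))
    ... | c , c∈centres = c , centres⁻ c∈centres

    module WithCentre (c : Fin (n G)) (c∈K : c ∈ K) (M⊆reach : M ⊆ reach M c) where

      I₁ : VertexSet (n G)
      I₁ = (⁅ a ⁆ ∪ K) ∖ ⁅ c ⁆

      ∁I₁≗⁅c⁆∪M : ∁ I₁ ≗ ⁅ c ⁆ ∪ M
      ∁I₁≗⁅c⁆∪M v = de-morgan (⁅ a ⁆ v ∨ K v) (⁅ c ⁆ v)
        where
        de-morgan : ∀ x z → not (x ∧ not z) ≡ z ∨ not x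
        de-morgan x     true  = cong not (∧-zeroʳ x)
        de-morgan true  false = refl
        de-morgan false false = refl

      reach≗∁I₁ : reach M c ≗ ∁ I₁
      reach≗∁I₁ = ⊆-antisym reach⊆∁I₁ ∁I₁⊆reach
        where
        reach⊆∁I₁ : reach M c ⊆ ∁ I₁
        reach⊆∁I₁ v v∈ = trans (∁I₁≗⁅c⁆∪M v) (reach⊆⁅c⁆∪M v v∈)
        ∁I₁⊆reach : ∁ I₁ ⊆ reach M c
        ∁I₁⊆reach v v∈ with ⁅ c ⁆ v in v∈⁅c⁆ | trans (sym (∁I₁≗⁅c⁆∪M v)) v∈
        ... | true  | _   = subst (_∈ reach M c) (sym (∈⁅⁆⇒≡ v∈⁅c⁆)) (c∈reach M c)
        ... | false | v∈M = M⊆reach v v∈M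

      a≢c : a ≢ c
      a≢c a≡c = case trans (sym a∉K) (subst (_∈ K) (sym a≡c) c∈K) of λ ()

      a∈I₁ : a ∈ I₁
      a∈I₁ rewrite u∈⁅u⁆ a | ≢⇒∉⁅⁆ a≢c = refl

      c∈∁I₁ : c ∈ ∁ I₁
      c∈∁I₁ rewrite u∈⁅u⁆ c = cong not (∧-zeroʳ _)

      ∣I₁∣≤k : ∣ I₁ ∣ ≤ k
      ∣I₁∣≤k = ≤-pred (begin-strict
        ∣ I₁ ∣              <⟨ p⊂q⇒∣p∣<∣q∣ {p = I₁} {⁅ a ⁆ ∪ K} (λ _ → ∧-conicalˡ _ _) c∈⁅a⁆∪K c∉I₁ ⟩
        ∣ ⁅ a ⁆ ∪ K ∣        ≤⟨ ∣p∪q∣≤∣p∣+∣q∣ ⁅ a ⁆ K ⟩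
        ∣ ⁅ a ⁆ ∣ + ∣ K ∣    ≡⟨ cong₂ _+_ (∣⁅v⁆∣≡1 a) ∣K∣≡k ⟩
        suc k               ∎)
        where
        open ≤-Reasoning
        c∈⁅a⁆∪K : c ∈ ⁅ a ⁆ ∪ K
        c∈⁅a⁆∪K = trans (cong (⁅ a ⁆ c ∨_) c∈K) (∨-zeroʳ _)
        c∉I₁ : c ∉ I₁
        c∉I₁ rewrite u∈⁅u⁆ c = ∧-zeroʳ _

      ∣∁I₁∣≤k : ∣ ∁ I₁ ∣ ≤ k
      ∣∁I₁∣≤k = begin
        ∣ ∁ I₁ ∣           ≡⟨ ∣∣-cong ∁I₁≗⁅c⁆∪M ⟩
        ∣ ⁅ c ⁆ ∪ M ∣      ≤⟨ ∣p∪q∣≤∣p∣+∣q∣ ⁅ c ⁆ M ⟩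
        ∣ ⁅ c ⁆ ∣ + ∣ M ∣  ≡⟨ cong (_+ ∣ M ∣) (∣⁅v⁆∣≡1 c) ⟩
        suc ∣ M ∣          ≤⟨ ∣M∣<k ⟩
        k                  ∎
        where open ≤-Reasoning

      rank₁ : Fin (n G) → ℕ
      rank₁ v = if ⁅ a ⁆ v then 0 else if K v then 1 else 2

      rank₁-a : rank₁ a ≡ 0
      rank₁-a rewrite u∈⁅u⁆ a = refl

      rank₁-K : ∀ {v} → v ≢ a → v ∈ K → rank₁ v ≡ 1
      rank₁-K v≢a v∈K rewrite ≢⇒∉⁅⁆ v≢a | v∈K = refl

      rank₁-∉K : ∀ {v} → v ≢ a → v ∉ K → rank₁ v ≡ 2
      rank₁-∉K v≢a v∉K rewrite ≢⇒∉⁅⁆ v≢a | v∉K = refl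

      rank₁-I₁ : ∀ {u} → u ∈ I₁ → rank₁ u ≤ 1
      rank₁-I₁ {u} u∈I₁ = go (∧-conicalˡ _ _ u∈I₁)
        where
        go : u ∈ ⁅ a ⁆ ∪ K → rank₁ u ≤ 1
        go u∈ with ⁅ a ⁆ u | K u
        ... | true  | _    = z≤n
        ... | false | true = ≤-refl

      parents₁ : HasParentsIn (adj G) I₁ rank₁ a
      parents₁ v v≢a = by-cases (K v) refl
        where
        by-cases : ∀ b → K v ≡ b → ∃ λ u → u ∈ I₁ × adj G u v ≡ true × rank₁ u < rank₁ v
        by-cases true v∈K =
          a , a∈I₁ , K⊆N⁺a v v∈K , subst₂ _<_ (sym rank₁-a) (sym (rank₁-K v≢a v∈K)) (s≤s z≤n)
        by-cases false v∉K with in-neighbour-outside {S = ∁ I₁} v∈∁I₁ ∣∁I₁∣≤k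
          where
          v∈∁I₁ : v ∈ ∁ I₁
          v∈∁I₁ rewrite ≢⇒∉⁅⁆ v≢a | v∉K = refl
        ... | u , u∉∁I₁ , uv =
          u , u∈I₁ , uv , subst (rank₁ u <_) (sym (rank₁-∉K v≢a v∉K)) (s≤s (rank₁-I₁ {u} u∈I₁))
          where
          u∈I₁ : u ∈ I₁
          u∈I₁ = not-injective {y = true} u∉∁I₁

      rank₂ : Fin (n G) → ℕ
      rank₂ v = entryTime (suc (n G)) (λ t → layer M c t v)

      rank₂≤ : ∀ {u t} → u ∈ layer M c t → rank₂ u ≤ t
      rank₂≤ {u} u∈ = entryTime≤ (layer-increasing M c u) u∈ (suc (n G))

      <rank₂ : ∀ {v t} → v ∉ layer M c t → t ≤ n G → t < rank₂ v
      <rank₂ {v} v∉ t≤n = entryTime> (layer-increasing M c v) v∉ (s≤s t≤n)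

      parents₂ : HasParentsIn (adj G) (∁ I₁) rank₂ c
      parents₂ v v≢c = by-cases (I₁ v) refl
        where
        by-cases : ∀ b → I₁ v ≡ b → ∃ λ u → u ∈ ∁ I₁ × adj G u v ≡ true × rank₂ u < rank₂ v
        by-cases true v∈I₁ with in-neighbour-outside {S = I₁} v∈I₁ ∣I₁∣≤k
        ... | u , u∉I₁ , uv =
          u , cong not u∉I₁ , uv , ≤-trans (s≤s (rank₂≤ u∈reach)) (<rank₂ v∉reach ≤-refl)
          where
          u∈reach : u ∈ reach M c
          u∈reach = trans (reach≗∁I₁ u) (cong not u∉I₁)
          v∉reach : v ∉ reach M c
          v∉reach = trans (reach≗∁I₁ v) (cong not v∈I₁)
        by-cases false v∉I₁ with crossing (λ t → layer M c t v) (≢⇒∉⁅⁆ v≢c) v∈reach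
          where
          v∈reach : v ∈ reach M c
          v∈reach = trans (reach≗∁I₁ v) (cong not v∉I₁)
        ... | t , t<n , v∉ₜ , v∈ₜ₊₁ with layer-new M {c} {t} {v} v∈ₜ₊₁ v∉ₜ
        ...   | u , u∈ₜ , uv =
          u , u∈∁I₁ , uv , ≤-trans (s≤s (rank₂≤ {u} {t} u∈ₜ)) (<rank₂ {v} {t} v∉ₜ (<⇒≤ t<n))
          where
          u∈∁I₁ : u ∈ ∁ I₁
          u∈∁I₁ = trans (sym (reach≗∁I₁ u)) (layer-increasing M c u {t} {n G} (<⇒≤ t<n) u∈ₜ)

      cisa : HasCISA2 G
      cisa = cisa-from-complementary G I₁ (arborescence-from-parents G rank₁ a∈I₁ parents₁)
                                          (arborescence-from-parents G rank₂ c∈∁I₁ parents₂)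

theorem3p31 : (G : Digraph) → n G ≥ 1 → MinSemidegreeAtLeastHalf G → HasCISA2 G
theorem3p31 G n≥1 δ⁰ =
  let a                   = fromℕ< n≥1
      (K , K⊆N⁺a , ∣K∣≡k) = ∃⊆-of-size (adj G a) k (k≤d⁺ a)
      (c , c∈K , M⊆reach) = WithRoot.∃-centre a K K⊆N⁺a ∣K∣≡k
  in  WithRoot.WithCentre.cisa a K K⊆N⁺a ∣K∣≡k c c∈K M⊆reach
  where open HalfSemidegree G δ⁰
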